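{- Let $\mathcal{A}$ be a complementary alphabet and $P$ a word of length $2n$ in $\mathcal{A}$ having at least one $P$-valid plane tree, and let $T_0$ be the $P$-valid plane tree produced by the greedy algorithm on $P$. Let $\mathcal{G}_P^+$ be the directed graph whose vertices are the $P$-valid plane trees, with a directed edge $T\to T'$ whenever there is a valid local move of type 2 from $T$ to $T'$. Then $\mathcal{G}_P^+$ has no directed cycles, and for every $P$-valid plane tree $T$ there is a directed path in $\mathcal{G}_P^+$ from $T$ to $T_0$ (i.e. a sequence of valid type 2 local moves transforming $T$ into $T_0$).
   Context: A complementary alphabet $\mathcal{A}$ is a finite set in which every letter $B$ has a unique complement $\overline{B}\in\mathcal{A}$, with $\overline{B}\neq B$ and $\overline{\overline{B}}=B$. A plane tree is a rooted tree in which the children of each vertex are linearly ordered. For a plane tree with $n$ edges, label the $2n$ half-edges $1,\dots,2n$ by starting on the left side of the leftmost edge at the root and walking counterclockwise; each edge is $e(i,j)$, $i<j$, with $i,j$ the labels of its sides. For $P=p_1\cdots p_{2n}$, a plane tree with $n$ edges is $P$-valid if $p_i,p_j$ are complements for every edge $e(i,j)$. Local moves, for $i<j<i'<j'$: type 1: if $e(i,j)$, $e(i',j')$ are edges sharing a vertex, replace them by $e(i,j')$, $e(j,i')$; type 2: if $e(i,j')$, $e(j,i')$ are edges sharing a vertex, replace them by $e(i,j)$, $e(i',j')$. A local move on a $P$-valid tree is valid if the result is $P$-valid. Greedy algorithm: process positions $i=1,\dots,2n$ in order; at $i$, let $j_i<i$ be the largest currently unmatched position; if $p_i,p_{j_i}$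 are complements, match them (edge $e(j_i,i)$), otherwise leave $i$ unmatched. When a $P$-valid tree exists the output is a $P$-valid plane tree $T_0$. -}

module Defs where

open import Data.Nat using (ℕ; zero; suc; _+_; _*_; _<_)
open import Data.Fin using (Fin)
open import Data.List using (List; []; _∷_; _++_; length; map)
open import Data.List.Membership.Propositional using (_∈_)
open import Data.List.Relation.Unary.All using (All)
open import Data.Maybe using (Maybe; just; nothing)
open import Data.Product using (Σ; ∃; _×_; _,_; proj₁; proj₂)
open import Data.Sum using (_⊎_)
open import Data.Empty using (⊥)
open import Relation.Nullary using (¬_; yes; no)
open import Relation.Binary.Definitions using (DecidableEquality)
open import Relation.Binary.PropositionalEquality using (_≡_)
open import Function.Bundles using (_↔_; _⇔_)

record CompAlphabet : Set₁ where
  field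
    Carrier    : Set
    _≟_        : DecidableEquality Carrier
    finite     : Σ ℕ (λ m → Carrier ↔ Fin m)
    comp       : Carrier → Carrier
    comp-invol : ∀ b → comp (comp b) ≡ b
    comp-nofix : ∀ b → ¬ (comp b ≡ b)

data PTree : Set where
  node : List PTree → PTree

-- An edge e(i,j) with i < j its side labels, together with the identities
-- of its upper (parent) vertex and lower (child) vertex.
-- Vertex identities: the root is 0; any other vertex is identified by the
-- label i of the left side of the edge leading down to it.
record Edge : Set where
  constructor edge
  field
    left   : ℕ
    right  : ℕ
    parent : ℕ
    child  : ℕ

-- Counterclockwise contour walk of the children list `cs` of a vertex with
-- identity v, with k labels already used; returns the edges and the number
-- of labels used afterwards.  Going down an edge uses label k+1, coming back
-- up it uses the next label after the subtree.
walk : List PTree → ℕ → ℕ → List Edge × ℕ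
walk [] v k = [] , k
walk (node ds ∷ cs) v k with walk ds (suc k) (suc k)
... | es₁ , k₁ with walk cs v (suc k₁)
... | es₂ , k₂ = (edge (suc k) (suc k₁) v (suc k) ∷ es₁) ++ es₂ , k₂

edges : PTree → List Edge
edges (node cs) = proj₁ (walk cs 0 0)

size : PTree → ℕ
size T = length (edges T)

pairOf : Edge → ℕ × ℕ
pairOf (edge i j _ _) = i , j

pairs : PTree → List (ℕ × ℕ)
pairs T = map pairOf (edges T)

ShareVertex : Edge → Edge → Set
ShareVertex (edge _ _ p c) (edge _ _ p' c') =
  (p ≡ p') ⊎ (p ≡ c') ⊎ (c ≡ p') ⊎ (c ≡ c')

module _ (𝒜 : CompAlphabet) where
  open CompAlphabet 𝒜

  -- 1-indexed letter of a word
  at : List Carrier → ℕ → Maybe Carrier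
  at [] _ = nothing
  at (x ∷ xs) zero = nothing
  at (x ∷ xs) (suc zero) = just x
  at (x ∷ xs) (suc (suc k)) = at xs (suc k)

  Complements : Maybe Carrier → Maybe Carrier → Set
  Complements (just a) (just b) = b ≡ comp a
  Complements _ _ = ⊥

  Valid : List Carrier → PTree → Set
  Valid P T = (length P ≡ 2 * size T)
            × All (λ e → Complements (at P (Edge.left e)) (at P (Edge.right e))) (edges T)

  -- Greedy algorithm.  `st` is the stack of unmatched positions (top first)
  -- with their letters, k the number of positions processed so far.
  greedyGo : List (ℕ × Carrier) → ℕ → List Carrier → List (ℕ × ℕ)
  greedyGo st k [] = []
  greedyGo [] k (x ∷ xs) = greedyGo ((suc k , x) ∷ []) (suc k) xs
  greedyGo ((j , y) ∷ st) k (x ∷ xs) with x ≟ comp y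
  ... | yes _ = (j , suc k) ∷ greedyGo st (suc k) xs
  ... | no _  = greedyGo ((suc k , x) ∷ (j , y) ∷ st) (suc k) xs

  greedy : List Carrier → List (ℕ × ℕ)
  greedy P = greedyGo [] 0 P

  IsGreedyTree : List Carrier → PTree → Set
  IsGreedyTree P T = ∀ p → (p ∈ pairs T) ⇔ (p ∈ greedy P)

  Type2 : List Carrier → PTree → PTree → Set
  Type2 P T T' =
    Valid P T × Valid P T' ×
    Σ ℕ λ i → Σ ℕ λ j → Σ ℕ λ i' → Σ ℕ λ j' →
    Σ Edge λ e₁ → Σ Edge λ e₂ →
      (i < j) × (j < i') × (i' < j') ×
      (e₁ ∈ edges T) × (pairOf e₁ ≡ (i , j')) ×
      (e₂ ∈ edges T) × (pairOf e₂ ≡ (j , i')) ×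
      ShareVertex e₁ e₂ ×
      (∀ p → (p ∈ pairs T') ⇔
             ((p ∈ pairs T × ¬ (p ≡ (i , j')) × ¬ (p ≡ (j , i')))
              ⊎ (p ≡ (i , j)) ⊎ (p ≡ (i' , j'))))

module Submission where

-- Weigh a plane tree by the total span Σ (j ∸ i) of its edges e(i , j).  A
-- type 2 move replaces the nested edges e(i , j'), e(j , i') by e(i , j),
-- e(i' , j') and lowers the weight by 2 (i' ∸ j), so G⁺_P has no directed
-- cycles.  If no edge of a P-valid tree has a left letter complementary to the
-- left letter of its parent edge, the greedy algorithm pushes at every left
-- side and pops at every right side, so the tree is T₀ (a plane tree is
-- determined by its set of edges).  Otherwise that parent and child edge
-- admit a valid type 2 move, and induction on the weight gives a path to T₀.

open import Defs
open import Data.Empty using (⊥; ⊥-elim)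
open import Data.List using (List; []; _∷_; _++_; length; map; drop; filter)
open import Data.List.Membership.Propositional using (_∈_)
open import Data.List.Membership.Propositional.Properties
  using (∈-∃++; ∈-++⁺ˡ; ∈-++⁺ʳ; ∈-map⁺; ∈-filter⁺; ∈-filter⁻)
open import Data.List.Properties
  using (++-assoc; ++-identityʳ; length-++; length-map; map-++; ∷-injective; drop-all)
open import Data.List.Relation.Binary.Permutation.Propositional
  using (_↭_; prep; ↭-refl; ↭-reflexive; ↭-sym; ↭-trans; ↭⇒↭ₛ; module PermutationReasoning)
import Data.List.Relation.Binary.Permutation.Propositional.Properties as Perm
import Data.List.Relation.Binary.Permutation.Setoid.Properties as Permₛ
open import Data.List.Relation.Binary.Subset.Propositional using (_⊆_)
open import Data.List.Relation.Unary.All as All using (All; []; _∷_)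
import Data.List.Relation.Unary.All.Properties as All
open import Data.List.Relation.Unary.AllPairs as AllPairs using (AllPairs; []; _∷_)
import Data.List.Relation.Unary.AllPairs.Properties as AllPairs
open import Data.List.Relation.Unary.Any using (here; there)
open import Data.List.Relation.Unary.Unique.Propositional using (Unique)
import Data.List.Relation.Unary.Unique.Propositional.Properties as Unique
open import Data.Maybe using (Maybe; just; nothing)
open import Data.Nat using (ℕ; zero; suc; _+_; _*_; _∸_; _≤_; _<_; z≤n; s≤s)
open import Data.Nat.Induction using (<-wellFounded)
open import Data.Nat.ListAction using (sum)
open import Data.Nat.ListAction.Properties using (sum-↭)
open import Data.Nat.Properties
open import Data.Nat.Tactic.RingSolver using (solve-∀)
open import Data.Product using (Σ; _×_; _,_; proj₁; proj₂)
open import Data.Product.Properties using (≡-dec)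
open import Data.Sum using (_⊎_; inj₁; inj₂)
open import Data.Unit using (⊤; tt)
open import Function.Bundles using (_⇔_; mk⇔; Equivalence)
open import Induction.WellFounded using (Acc; acc)
open import Relation.Binary.Construct.Closure.ReflexiveTransitive using (Star; ε; _◅_)
open import Relation.Binary.Construct.Closure.Transitive using (TransClosure; [_]; _∷_)
open import Relation.Binary.PropositionalEquality
open import Relation.Nullary using (¬_; Dec; yes; no; ¬?; _×-dec_)

KeySorted : {A : Set} → (A → ℕ) → List A → Set
KeySorted key = AllPairs (λ x y → key x < key y)

keySorted-⊆-antisym : {A : Set} (key : A → ℕ) {xs ys : List A} →
  KeySorted key xs → KeySorted key ys → xs ⊆ ys → ys ⊆ xs → xs ≡ ys
keySorted-⊆-antisym key {[]}     {[]}     _ _ _ _ = refl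
keySorted-⊆-antisym key {[]}     {y ∷ ys} _ _ _ ys⊆ with ys⊆ (here refl)
... | ()
keySorted-⊆-antisym key {x ∷ xs} {[]}     _ _ xs⊆ _ with xs⊆ (here refl)
... | ()
keySorted-⊆-antisym key {x ∷ xs} {y ∷ ys} (x< ∷ sxs) (y< ∷ sys) xs⊆ ys⊆
  with xs⊆ (here refl) | ys⊆ (here refl)
... | there x∈ys | there y∈xs = ⊥-elim (<-asym (All.lookup x< y∈xs) (All.lookup y< x∈ys))
... | there x∈ys | here y≡x  = ⊥-elim (<-irrefl (cong key y≡x) (All.lookup y< x∈ys))
... | here x≡y   | _ rewrite x≡y =
  cong (y ∷_) (keySorted-⊆-antisym key sxs sys (tail-⊆ x< xs⊆) (tail-⊆ y< ys⊆))
  where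
  tail-⊆ : ∀ {zs ws} → All (λ z → key y < key z) zs → y ∷ zs ⊆ y ∷ ws → zs ⊆ ws
  tail-⊆ y< ⊆ z∈ with ⊆ (there z∈)
  ... | here refl = ⊥-elim (<-irrefl refl (All.lookup y< z∈))
  ... | there z∈ws = z∈ws

++-split : {A : Set} (xs xs' : List A) {ys ys' : List A} →
  length xs ≡ length xs' → xs ++ ys ≡ xs' ++ ys' → xs ≡ xs' × ys ≡ ys'
++-split []       []         _   eq = refl , eq
++-split (x ∷ xs) (x' ∷ xs') len eq with ∷-injective eq
... | refl , eq' with ++-split xs xs' (suc-injective len) eq'
... | refl , refl = refl , refl

sum-map-mono-⊆ : {A : Set} (f : A → ℕ) {xs ys : List A} →
  Unique xs → xs ⊆ ys → sum (map f xs) ≤ sum (map f ys)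
sum-map-mono-⊆ f {[]}     _           _   = z≤n
sum-map-mono-⊆ f {x ∷ xs} (x∉xs ∷ u) xs⊆ with ∈-∃++ (xs⊆ (here refl))
... | as , bs , refl = begin
  f x + sum (map f xs)         ≤⟨ +-monoʳ-≤ (f x) (sum-map-mono-⊆ f u xs⊆as++bs) ⟩
  f x + sum (map f (as ++ bs)) ≡⟨ sum-↭ (Perm.map⁺ f (↭-sym (Perm.shift x as bs))) ⟩
  sum (map f (as ++ x ∷ bs))   ∎
  where
  open ≤-Reasoning
  xs⊆as++bs : xs ⊆ as ++ bs
  xs⊆as++bs z∈xs with Perm.∈-resp-↭ (Perm.shift x as bs) (xs⊆ (there z∈xs))
  ... | here refl = ⊥-elim (All.lookup x∉xs z∈xs refl)
  ... | there z∈  = z∈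

record Replaces {A : Set} (x y x' y' : A) (old new : List A) : Set where
  field
    rest : List A
    old↭ : old ↭ x ∷ y ∷ rest
    new↭ : new ↭ x' ∷ y' ∷ rest

module _ {A : Set} {x y x' y' : A} where

  Replaces-frameˡ : ∀ {old new} F → Replaces x y x' y' old new → Replaces x y x' y' (F ++ old) (F ++ new)
  Replaces-frameˡ F r = record
    { rest = F ++ rest
    ; old↭ = ↭-trans (Perm.++⁺ˡ F old↭) (Perm.shifts F (x ∷ y ∷ []))
    ; new↭ = ↭-trans (Perm.++⁺ˡ F new↭) (Perm.shifts F (x' ∷ y' ∷ []))
    }
    where open Replaces r

  Replaces-frameʳ : ∀ {old new} G → Replaces x y x' y' old new → Replaces x y x' y' (old ++ G) (new ++ G)
  Replaces-frameʳ G r = record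
    { rest = rest ++ G ; old↭ = Perm.++⁺ʳ G old↭ ; new↭ = Perm.++⁺ʳ G new↭ }
    where open Replaces r

  Replaces-length : ∀ {old new} → Replaces x y x' y' old new → length new ≡ length old
  Replaces-length r = trans (Perm.↭-length new↭) (sym (Perm.↭-length old↭))
    where open Replaces r

  Replaces-All : ∀ {P : A → Set} {old new} → Replaces x y x' y' old new →
    All P old → P x' → P y' → All P new
  Replaces-All r Pold Px' Py' =
    Perm.All-resp-↭ (↭-sym new↭) (Px' ∷ Py' ∷ All.tail (All.tail (Perm.All-resp-↭ old↭ Pold)))
    where open Replaces r

  Replaces-∈⇔ : ∀ {old new} → Unique old → Replaces x y x' y' old new →
    ∀ z → z ∈ new ⇔ ((z ∈ old × z ≢ x × z ≢ y) ⊎ z ≡ x' ⊎ z ≡ y')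
  Replaces-∈⇔ {old} {new} uold r z = mk⇔ to from
    where
    open Replaces r
    unique : Unique (x ∷ y ∷ rest)
    unique = Permₛ.Unique-resp-↭ (setoid A) (↭⇒↭ₛ old↭) uold
    to : z ∈ new → (z ∈ old × z ≢ x × z ≢ y) ⊎ z ≡ x' ⊎ z ≡ y'
    to z∈ with Perm.∈-resp-↭ new↭ z∈ | unique
    ... | here z≡x'           | _ = inj₂ (inj₁ z≡x')
    ... | there (here z≡y')   | _ = inj₂ (inj₂ z≡y')
    ... | there (there z∈rest) | (_ ∷ x∉rest) ∷ y∉rest ∷ _ =
      inj₁ ( Perm.∈-resp-↭ (↭-sym old↭) (there (there z∈rest))
           , (λ z≡x → All.lookup x∉rest z∈rest (sym z≡x))
           , (λ z≡y → All.lookup y∉rest z∈rest (sym z≡y)) )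
    from : (z ∈ old × z ≢ x × z ≢ y) ⊎ z ≡ x' ⊎ z ≡ y' → z ∈ new
    from (inj₂ (inj₁ refl)) = Perm.∈-resp-↭ (↭-sym new↭) (here refl)
    from (inj₂ (inj₂ refl)) = Perm.∈-resp-↭ (↭-sym new↭) (there (here refl))
    from (inj₁ (z∈old , z≢x , z≢y)) with Perm.∈-resp-↭ old↭ z∈old
    ... | here z≡x            = ⊥-elim (z≢x z≡x)
    ... | there (here z≡y)    = ⊥-elim (z≢y z≡y)
    ... | there (there z∈rest) = Perm.∈-resp-↭ (↭-sym new↭) (there (there z∈rest))

nested↭ : {A : Set} (x y : A) (O Es D C : List A) →
  x ∷ ((O ++ y ∷ (Es ++ D)) ++ C) ↭ x ∷ y ∷ O ++ Es ++ D ++ C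
nested↭ x y O Es D C = prep x (begin
  (O ++ y ∷ (Es ++ D)) ++ C ≡⟨ ++-assoc O (y ∷ Es ++ D) C ⟩
  O ++ y ∷ ((Es ++ D) ++ C) ≡⟨ cong (λ zs → O ++ y ∷ zs) (++-assoc Es D C) ⟩
  O ++ y ∷ (Es ++ D ++ C)   ↭⟨ Perm.shift y O (Es ++ D ++ C) ⟩
  y ∷ O ++ Es ++ D ++ C     ∎)
  where open PermutationReasoning

unnested↭ : {A : Set} (x y : A) (O Es D C : List A) →
  x ∷ O ++ Es ++ y ∷ (D ++ C) ↭ x ∷ y ∷ O ++ Es ++ D ++ C
unnested↭ x y O Es D C = prep x (begin
  O ++ Es ++ y ∷ (D ++ C)   ≡⟨ ++-assoc O Es (y ∷ D ++ C) ⟨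
  (O ++ Es) ++ y ∷ (D ++ C) ↭⟨ Perm.shift y (O ++ Es) (D ++ C) ⟩
  y ∷ (O ++ Es) ++ D ++ C   ≡⟨ cong (y ∷_) (++-assoc O Es (D ++ C)) ⟩
  y ∷ O ++ Es ++ D ++ C     ∎)
  where open PermutationReasoning

-- Contours of plane forests

Pair : Set
Pair = ℕ × ℕ

-- Defs.walk with the vertex identities forgotten.
contourEnd : List PTree → ℕ → ℕ
contourEnd []              k = k
contourEnd (node ds ∷ cs) k = contourEnd cs (suc (contourEnd ds (suc k)))

contourPairs : List PTree → ℕ → List Pair
contourPairs []              k = []
contourPairs (node ds ∷ cs) k =
  ((suc k , suc E) ∷ contourPairs ds (suc k)) ++ contourPairs cs (suc E)
  where E = contourEnd ds (suc k)

walk-∷ : ∀ ds cs v k → walk (node ds ∷ cs) v k ≡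
  let es₁ , k₁ = walk ds (suc k) (suc k)
      es₂ , k₂ = walk cs v (suc k₁)
  in (edge (suc k) (suc k₁) v (suc k) ∷ es₁) ++ es₂ , k₂
walk-∷ ds cs v k with walk ds (suc k) (suc k)
... | es₁ , k₁ with walk cs v (suc k₁)
... | es₂ , k₂ = refl

walk-end : ∀ cs v k → proj₂ (walk cs v k) ≡ contourEnd cs k
walk-end []              v k = refl
walk-end (node ds ∷ cs) v k
  rewrite walk-∷ ds cs v k | walk-end ds (suc k) (suc k) = walk-end cs v _

walk-pairs : ∀ cs v k → map pairOf (proj₁ (walk cs v k)) ≡ contourPairs cs k
walk-pairs []              v k = refl
walk-pairs (node ds ∷ cs) v k rewrite walk-∷ ds cs v k | walk-end ds (suc k) (suc k) =
  begin
    map pairOf ((e ∷ es₁) ++ es₂)          ≡⟨ map-++ pairOf (e ∷ es₁) es₂ ⟩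
    map pairOf (e ∷ es₁) ++ map pairOf es₂ ≡⟨ cong₂ (λ xs ys → (pairOf e ∷ xs) ++ ys)
                                                     (walk-pairs ds (suc k) (suc k)) (walk-pairs cs v _) ⟩
    _ ∎
  where
  open ≡-Reasoning
  E = contourEnd ds (suc k)
  e = edge (suc k) (suc E) v (suc k)
  es₁ = proj₁ (walk ds (suc k) (suc k))
  es₂ = proj₁ (walk cs v (suc E))

pairs-node : ∀ cs → pairs (node cs) ≡ contourPairs cs 0
pairs-node cs = walk-pairs cs 0 0

walk-++ : ∀ xs ys v k → walk (xs ++ ys) v k ≡
  (proj₁ (walk xs v k) ++ proj₁ (walk ys v (proj₂ (walk xs v k))) , proj₂ (walk ys v (proj₂ (walk xs v k))))
walk-++ []              ys v k = refl
walk-++ (node ds ∷ xs) ys v k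
  rewrite walk-∷ ds (xs ++ ys) v k | walk-∷ ds xs v k
        | walk-++ xs ys v (suc (proj₂ (walk ds (suc k) (suc k)))) =
  cong₂ _,_ (sym (++-assoc (_ ∷ proj₁ (walk ds (suc k) (suc k))) _ _)) refl

contourEnd-++ : ∀ xs ys k → contourEnd (xs ++ ys) k ≡ contourEnd ys (contourEnd xs k)
contourEnd-++ []              ys k = refl
contourEnd-++ (node ds ∷ xs) ys k = contourEnd-++ xs ys _

contourPairs-++ : ∀ xs ys k → contourPairs (xs ++ ys) k ≡ contourPairs xs k ++ contourPairs ys (contourEnd xs k)
contourPairs-++ []              ys k = refl
contourPairs-++ (node ds ∷ xs) ys k rewrite contourPairs-++ xs ys (suc (contourEnd ds (suc k))) =
  sym (++-assoc (_ ∷ contourPairs ds (suc k)) _ _)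

≤-contourEnd : ∀ cs k → k ≤ contourEnd cs k
≤-contourEnd []              k = ≤-refl
≤-contourEnd (node ds ∷ cs) k =
  ≤-trans (n≤1+n k) (≤-trans (≤-contourEnd ds (suc k)) (≤-trans (n≤1+n _) (≤-contourEnd cs _)))

contourEnd-length : ∀ cs k → contourEnd cs k ≡ k + 2 * length (contourPairs cs k)
contourEnd-length []              k = sym (+-identityʳ k)
contourEnd-length (node ds ∷ cs) k
  rewrite contourEnd-length cs (suc (contourEnd ds (suc k))) | contourEnd-length ds (suc k)
        | length-++ (contourPairs ds (suc k)) {contourPairs cs (suc (suc k + 2 * length (contourPairs ds (suc k))))} =
  regroup k (length (contourPairs ds (suc k))) _
  where
  regroup : ∀ k a b → suc (suc k + 2 * a) + 2 * b ≡ k + 2 * suc (a + b)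
  regroup = solve-∀

contourEnd-size : ∀ cs → contourEnd cs 0 ≡ 2 * size (node cs)
contourEnd-size cs = begin
  contourEnd cs 0                              ≡⟨ contourEnd-length cs 0 ⟩
  2 * length (contourPairs cs 0)               ≡⟨ cong (λ ps → 2 * length ps) (pairs-node cs) ⟨
  2 * length (map pairOf (edges (node cs)))    ≡⟨ cong (2 *_) (length-map pairOf (edges (node cs))) ⟩
  2 * size (node cs)                           ∎
  where open ≡-Reasoning

contourEnd≡⇒length≡ : ∀ cs cs' k → contourEnd cs k ≡ contourEnd cs' k →
  length (contourPairs cs k) ≡ length (contourPairs cs' k)
contourEnd≡⇒length≡ cs cs' k eq rewrite contourEnd-length cs k | contourEnd-length cs' k =
  *-cancelˡ-≡ _ _ 2 (+-cancelˡ-≡ k _ _ eq)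

length≡⇒contourEnd≡ : ∀ cs cs' k → length (contourPairs cs k) ≡ length (contourPairs cs' k) →
  contourEnd cs k ≡ contourEnd cs' k
length≡⇒contourEnd≡ cs cs' k len rewrite contourEnd-length cs k | contourEnd-length cs' k | len = refl

Between : ℕ → ℕ → Pair → Set
Between k e (i , j) = k < i × i < j × j ≤ e

contourPairs-between : ∀ cs k → All (Between k (contourEnd cs k)) (contourPairs cs k)
contourPairs-between []              k = []
contourPairs-between (node ds ∷ cs) k =
  (n<1+n k , s≤s (≤-contourEnd ds (suc k)) , ≤-contourEnd cs _)
  ∷ All.++⁺ (All.map (λ (a , b , c) → <-trans (n<1+n k) a , b , ≤-trans c E≤end)
                     (contourPairs-between ds (suc k)))
            (All.map (λ (a , b , c) → <-trans (s≤s k≤E) a , b , c) (contourPairs-between cs _))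
  where
  E = contourEnd ds (suc k)
  E≤end : E ≤ contourEnd cs (suc E)
  E≤end = ≤-trans (n≤1+n E) (≤-contourEnd cs _)
  k≤E : k ≤ E
  k≤E = ≤-trans (n≤1+n k) (≤-contourEnd ds (suc k))

contourPairs-sorted : ∀ cs k → KeySorted proj₁ (contourPairs cs k)
contourPairs-sorted []              k = []
contourPairs-sorted (node ds ∷ cs) k =
  All.++⁺ (All.map proj₁ (contourPairs-between ds (suc k)))
          (All.map (λ (a , _) → <-trans (s≤s (≤-contourEnd ds (suc k))) a) (contourPairs-between cs _))
  ∷ AllPairs.++⁺ (contourPairs-sorted ds (suc k)) (contourPairs-sorted cs _)
      (All.map (λ (_ , b , c) → All.map (λ (a' , _) → <-trans b (<-trans (s≤s c) a'))
                                        (contourPairs-between cs _))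
               (contourPairs-between ds (suc k)))

contourPairs-unique : ∀ cs k → Unique (contourPairs cs k)
contourPairs-unique cs k = AllPairs.map (λ lt eq → <-irrefl (cong proj₁ eq) lt) (contourPairs-sorted cs k)

pairs-unique : ∀ T → Unique (pairs T)
pairs-unique (node cs) = subst Unique (sym (pairs-node cs)) (contourPairs-unique cs 0)

contourPairs-injective : ∀ cs cs' k → contourPairs cs k ≡ contourPairs cs' k → cs ≡ cs'
contourPairs-injective []              []                k eq = refl
contourPairs-injective []              (node ds' ∷ cs') k ()
contourPairs-injective (node ds ∷ cs) []                k ()
contourPairs-injective (node ds ∷ cs) (node ds' ∷ cs') k eq with ∷-injective eq
... | head≡ , tail≡ with suc-injective (cong proj₂ head≡)
... | E≡E' with ++-split (contourPairs ds (suc k)) (contourPairs ds' (suc k))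
                         (contourEnd≡⇒length≡ ds ds' (suc k) E≡E') tail≡
... | ds≡ , cs≡ rewrite E≡E' =
  cong₂ (λ ds cs → node ds ∷ cs) (contourPairs-injective ds ds' (suc k) ds≡)
                                 (contourPairs-injective cs cs' _ cs≡)

-- Total span

span : Pair → ℕ
span (i , j) = j ∸ i

weight : List Pair → ℕ
weight ps = sum (map span ps)

private
  +-suc-regroup : ∀ i a b c → suc (i + a) + b + c ≡ i + suc (a + b + c)
  +-suc-regroup = solve-∀

span-unnest< : ∀ {i j i' j'} → i ≤ j → j < i' → i' ≤ j' →
  span (i , j) + span (i' , j') < span (i , j') + span (j , i')
span-unnest< {i} i≤j j<i' i'≤j'
  with m≤n⇒∃[o]m+o≡n i≤j | m≤n⇒∃[o]m+o≡n j<i' | m≤n⇒∃[o]m+o≡n i'≤j'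
... | a , refl | b , refl | c , refl
  rewrite m+n∸m≡n i a | m+n∸m≡n (suc (i + a) + b) c
        | cong (_∸ i) (+-suc-regroup i a b c) | m+n∸m≡n i (suc (a + b + c))
        | cong (_∸ (i + a)) (sym (+-suc (i + a) b)) | m+n∸m≡n (i + a) (suc b) =
  s≤s (≤-trans (+-monoˡ-≤ c (m≤m+n a b)) (m≤m+n (a + b + c) (suc b)))

-- Type 2 moves and the greedy tree

module Word (𝒜 : CompAlphabet) (P : List (CompAlphabet.Carrier 𝒜)) where
  open CompAlphabet 𝒜 using (Carrier; comp; comp-invol) renaming (_≟_ to _≟ᶜ_)

  Type2-weight< : ∀ T T' → Type2 𝒜 P T T' → weight (pairs T') < weight (pairs T)
  Type2-weight< T T'
    (_ , _ , i , j , i' , j' , e₁ , e₂ , i<j , j<i' , i'<j' , e₁∈ , e₁≡ , e₂∈ , e₂≡ , _ , T'⇔) =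
    begin-strict
      weight (pairs T')                            ≤⟨ sum-map-mono-⊆ span (pairs-unique T') T'⊆ ⟩
      span A + (span B + weight R)                 ≡⟨ sym (+-assoc (span A) _ _) ⟩
      span A + span B + weight R                   <⟨ +-monoˡ-< (weight R) unnest< ⟩
      span X + span Y + weight R                   ≡⟨ +-assoc (span X) _ _ ⟩
      weight (X ∷ Y ∷ R)                           ≤⟨ sum-map-mono-⊆ span XYR-unique XYR⊆ ⟩
      weight (pairs T)                             ∎
    where
    open ≤-Reasoning
    unnest< = span-unnest< (<⇒≤ i<j) j<i' (<⇒≤ i'<j')
    X Y A B : Pair
    X = i , j'
    Y = j , i'
    A = i , j
    B = i' , j'
    away? : ∀ p → Dec (p ≢ X × p ≢ Y)
    away? p = ¬? (≡-dec _≟_ _≟_ p X) ×-dec ¬? (≡-dec _≟_ _≟_ p Y)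
    R : List Pair
    R = filter away? (pairs T)
    R⁻ : ∀ {p} → p ∈ R → p ∈ pairs T × p ≢ X × p ≢ Y
    R⁻ = ∈-filter⁻ away?
    T'⊆ : pairs T' ⊆ A ∷ B ∷ R
    T'⊆ {p} p∈ with Equivalence.to (T'⇔ p) p∈
    ... | inj₁ (p∈T , p≢X , p≢Y) = there (there (∈-filter⁺ away? p∈T (p≢X , p≢Y)))
    ... | inj₂ (inj₁ refl)       = here refl
    ... | inj₂ (inj₂ refl)       = there (here refl)
    XYR⊆ : X ∷ Y ∷ R ⊆ pairs T
    XYR⊆ (here refl)         = subst (_∈ pairs T) e₁≡ (∈-map⁺ pairOf e₁∈)
    XYR⊆ (there (here refl)) = subst (_∈ pairs T) e₂≡ (∈-map⁺ pairOf e₂∈)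
    XYR⊆ (there (there p∈R)) = proj₁ (R⁻ p∈R)
    XYR-unique : Unique (X ∷ Y ∷ R)
    XYR-unique =
      ( (λ X≡Y → <-irrefl (cong proj₁ X≡Y) i<j)
      ∷ All.tabulate (λ p∈R X≡p → proj₁ (proj₂ (R⁻ p∈R)) (sym X≡p)))
      ∷ All.tabulate (λ p∈R Y≡p → proj₂ (proj₂ (R⁻ p∈R)) (sym Y≡p))
      ∷ Unique.filter⁺ away? (pairs-unique T)

  TransClosure-weight< : ∀ {T T'} → TransClosure (Type2 𝒜 P) T T' → weight (pairs T') < weight (pairs T)
  TransClosure-weight< {T} {T'} [ step ]         = Type2-weight< T T' step
  TransClosure-weight< {T} (_∷_ {y = U} step steps) = <-trans (TransClosure-weight< steps) (Type2-weight< T U step)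

  ValidPair : Pair → Set
  ValidPair (i , j) = Complements 𝒜 (at 𝒜 P i) (at 𝒜 P j)

  valid⇒contour : ∀ cs → Valid 𝒜 P (node cs) →
    contourEnd cs 0 ≡ length P × All ValidPair (contourPairs cs 0)
  valid⇒contour cs (len , edges-valid) =
    trans (contourEnd-size cs) (sym len) , subst (All ValidPair) (pairs-node cs) (All.map⁺ edges-valid)

  contour⇒valid : ∀ cs → contourEnd cs 0 ≡ length P → All ValidPair (contourPairs cs 0) →
    Valid 𝒜 P (node cs)
  contour⇒valid cs end≡ pairs-valid =
    trans (sym end≡) (contourEnd-size cs) , All.map⁻ (subst (All ValidPair) (sym (pairs-node cs)) pairs-valid)

  at⇒drop : ∀ (xs : List Carrier) k {x} → at 𝒜 xs (suc k) ≡ just x → drop k xs ≡ x ∷ drop (suc k) xs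
  at⇒drop (y ∷ ys) zero    refl = refl
  at⇒drop (y ∷ ys) (suc k) eq   = at⇒drop ys k eq

  Complements⇒just : ∀ {ma mb} → Complements 𝒜 ma mb →
    Σ Carrier λ a → ma ≡ just a × mb ≡ just (comp a)
  Complements⇒just {just a} {just .(comp a)} refl = a , refl , refl

  TopLetter : List (ℕ × Carrier) → Maybe Carrier → Set
  TopLetter []            nothing  = ⊤
  TopLetter ((_ , a) ∷ _) (just b) = a ≡ b
  TopLetter _             _        = ⊥

  greedyGo-push : ∀ st y k b rest → TopLetter st y → ¬ Complements 𝒜 y (just b) →
    greedyGo 𝒜 st k (b ∷ rest) ≡ greedyGo 𝒜 ((suc k , b) ∷ st) (suc k) rest
  greedyGo-push []            nothing  k b rest _    _  = refl
  greedyGo-push ((j , a) ∷ st) (just .a) k b rest refl nc with b ≟ᶜ comp a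
  ... | yes b≡a̅ = ⊥-elim (nc b≡a̅)
  ... | no  _   = refl

  greedyGo-pop : ∀ j b st k c rest → c ≡ comp b →
    greedyGo 𝒜 ((j , b) ∷ st) k (c ∷ rest) ≡ (j , suc k) ∷ greedyGo 𝒜 st (suc k) rest
  greedyGo-pop j b st k c rest c≡b̅ with c ≟ᶜ comp b
  ... | yes _   = refl
  ... | no  c≢b̅ = ⊥-elim (c≢b̅ c≡b̅)

  -- y is the left letter of the parent edge (nothing at the root).
  Reduced : Maybe Carrier → List PTree → ℕ → Set
  Reduced y []              k = ⊤
  Reduced y (node ds ∷ cs) k =
    ¬ Complements 𝒜 y (at 𝒜 P (suc k))
    × Reduced (at 𝒜 P (suc k)) ds (suc k)
    × Reduced y cs (suc (contourEnd ds (suc k)))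

  greedyGo-reduced : ∀ y cs k st → TopLetter st y → Reduced y cs k → All ValidPair (contourPairs cs k) →
    Σ (List Pair) λ out →
      greedyGo 𝒜 st k (drop k P) ≡ out ++ greedyGo 𝒜 st (contourEnd cs k) (drop (contourEnd cs k) P)
      × out ↭ contourPairs cs k
  greedyGo-reduced y []              k st _   _                          _ = [] , refl , ↭-refl
  greedyGo-reduced y (node ds ∷ cs) k st top (no-pop , red-ds , red-cs) (e-valid ∷ valid)
    with All.++⁻ (contourPairs ds (suc k)) valid | Complements⇒just e-valid
  ... | valid-ds , valid-cs | b , at-i , at-j
    with greedyGo-reduced (just b) ds (suc k) ((suc k , b) ∷ st) refl
                          (subst (λ z → Reduced z ds (suc k)) at-i red-ds) valid-ds
       | greedyGo-reduced y cs (suc (contourEnd ds (suc k))) st top red-cs valid-cs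
  ... | out₁ , run₁ , out₁↭ | out₂ , run₂ , out₂↭ =
    out₁ ++ (suc k , suc E) ∷ out₂ ,
    (begin
      greedyGo 𝒜 st k (drop k P)
        ≡⟨ cong (greedyGo 𝒜 st k) (at⇒drop P k at-i) ⟩
      greedyGo 𝒜 st k (b ∷ drop (suc k) P)
        ≡⟨ greedyGo-push st y k b _ top (subst (λ z → ¬ Complements 𝒜 y z) at-i no-pop) ⟩
      greedyGo 𝒜 ((suc k , b) ∷ st) (suc k) (drop (suc k) P)
        ≡⟨ run₁ ⟩
      out₁ ++ greedyGo 𝒜 ((suc k , b) ∷ st) E (drop E P)
        ≡⟨ cong (λ z → out₁ ++ greedyGo 𝒜 ((suc k , b) ∷ st) E z) (at⇒drop P E at-j) ⟩
      out₁ ++ greedyGo 𝒜 ((suc k , b) ∷ st) E (comp b ∷ drop (suc E) P)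
        ≡⟨ cong (out₁ ++_) (greedyGo-pop (suc k) b st E _ _ refl) ⟩
      out₁ ++ (suc k , suc E) ∷ greedyGo 𝒜 st (suc E) (drop (suc E) P)
        ≡⟨ cong (λ z → out₁ ++ (suc k , suc E) ∷ z) run₂ ⟩
      out₁ ++ (suc k , suc E) ∷ (out₂ ++ _)
        ≡⟨ ++-assoc out₁ _ _ ⟨
      (out₁ ++ (suc k , suc E) ∷ out₂) ++ _ ∎) ,
    ↭-trans (Perm.shift (suc k , suc E) out₁ out₂) (prep _ (Perm.++⁺ out₁↭ out₂↭))
    where
    open ≡-Reasoning
    E = contourEnd ds (suc k)

  greedy-reduced : ∀ cs → Valid 𝒜 P (node cs) → Reduced nothing cs 0 → greedy 𝒜 P ↭ contourPairs cs 0
  greedy-reduced cs valid red with valid⇒contour cs valid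
  ... | end≡ , pairs-valid with greedyGo-reduced nothing cs 0 [] tt red pairs-valid
  ... | out , run , out↭ = subst (_↭ contourPairs cs 0) (sym greedy≡out) out↭
    where
    open ≡-Reasoning
    greedy≡out : greedy 𝒜 P ≡ out
    greedy≡out = begin
      greedyGo 𝒜 [] 0 P
        ≡⟨ run ⟩
      out ++ greedyGo 𝒜 [] _ (drop (contourEnd cs 0) P)
        ≡⟨ cong (λ xs → out ++ greedyGo 𝒜 [] _ xs) drop-end ⟩
      out ++ []
        ≡⟨ ++-identityʳ out ⟩
      out ∎
      where
      drop-end : drop (contourEnd cs 0) P ≡ []
      drop-end = drop-all (contourEnd cs 0) P (≤-reflexive (sym end≡))

  reduced⇒greedyTree : ∀ cs T₀ → Valid 𝒜 P (node cs) → Reduced nothing cs 0 →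
    IsGreedyTree 𝒜 P T₀ → node cs ≡ T₀
  reduced⇒greedyTree cs (node cs₀) valid red greedy₀ =
    cong node (contourPairs-injective cs cs₀ 0
      (keySorted-⊆-antisym proj₁ (contourPairs-sorted cs 0) (contourPairs-sorted cs₀ 0) ⊆₀ ⊇₀))
    where
    greedy↭ : greedy 𝒜 P ↭ contourPairs cs 0
    greedy↭ = greedy-reduced cs valid red
    ⊆₀ : contourPairs cs 0 ⊆ contourPairs cs₀ 0
    ⊆₀ p∈ = subst (_ ∈_) (pairs-node cs₀)
                  (Equivalence.from (greedy₀ _) (Perm.∈-resp-↭ (↭-sym greedy↭) p∈))
    ⊇₀ : contourPairs cs₀ 0 ⊆ contourPairs cs 0
    ⊇₀ p∈ = Perm.∈-resp-↭ greedy↭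
                  (Equivalence.to (greedy₀ _) (subst (_ ∈_) (sym (pairs-node cs₀)) p∈))

  ValidPair-unnest : ∀ {i j i' j'} →
    ValidPair (i , j') → ValidPair (i , j) → ValidPair (j , i') → ValidPair (i' , j')
  ValidPair-unnest {i} {j} {i'} {j'} ij' ij ji' with at 𝒜 P i | at 𝒜 P j | at 𝒜 P i' | at 𝒜 P j'
  ... | just a | just b | just c | just d =
    trans ij' (trans (sym ij) (trans (sym (comp-invol b)) (cong comp (sym ji'))))

  -- A type 2 move inside the forest cs of the subtree hanging from vertex v,
  -- whose contour starts after label k.
  record Move (cs : List PTree) (v k : ℕ) : Set where
    field
      cs'          : List PTree
      i j i' j'    : ℕ
      i<j          : i < j
      j<i'         : j < i'
      i'<j'        : i' < j'
      e₁ e₂        : Edge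
      e₁∈          : e₁ ∈ proj₁ (walk cs v k)
      e₁≡          : pairOf e₁ ≡ (i , j')
      e₂∈          : e₂ ∈ proj₁ (walk cs v k)
      e₂≡          : pairOf e₂ ≡ (j , i')
      shared       : ShareVertex e₁ e₂
      replaces     : Replaces (i , j') (j , i') (i , j) (i' , j') (contourPairs cs k) (contourPairs cs' k)
      valid-ij     : ValidPair (i , j)
      valid-i'j'   : ValidPair (i' , j')

  Move⇒Type2 : ∀ cs → Valid 𝒜 P (node cs) → (m : Move cs 0 0) →
    Type2 𝒜 P (node cs) (node (Move.cs' m))
  Move⇒Type2 cs valid m =
    valid , valid' , i , j , i' , j' , e₁ , e₂ , i<j , j<i' , i'<j' ,
    e₁∈ , e₁≡ , e₂∈ , e₂≡ , shared , pairs⇔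
    where
    open Move m
    end≡ : contourEnd cs 0 ≡ length P
    end≡ = proj₁ (valid⇒contour cs valid)
    valid' : Valid 𝒜 P (node cs')
    valid' = contour⇒valid cs'
      (trans (length≡⇒contourEnd≡ cs' cs 0 (Replaces-length replaces)) end≡)
      (Replaces-All replaces (proj₂ (valid⇒contour cs valid)) valid-ij valid-i'j')
    pairs⇔ : ∀ p → (p ∈ pairs (node cs')) ⇔
      ((p ∈ pairs (node cs) × ¬ p ≡ (i , j') × ¬ p ≡ (j , i')) ⊎ p ≡ (i , j) ⊎ p ≡ (i' , j'))
    pairs⇔ p = subst₂
      (λ L L' → (p ∈ L') ⇔
                ((p ∈ L × ¬ p ≡ (i , j') × ¬ p ≡ (j , i')) ⊎ p ≡ (i , j) ⊎ p ≡ (i' , j')))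
      (sym (pairs-node cs)) (sym (pairs-node cs')) (Replaces-∈⇔ (contourPairs-unique cs 0) replaces p)

  ∈-walk-child : ∀ {ds cs v k e} → e ∈ proj₁ (walk ds (suc k) (suc k)) →
    e ∈ proj₁ (walk (node ds ∷ cs) v k)
  ∈-walk-child {ds} {cs} {v} {k} {e} e∈ =
    subst (λ w → e ∈ proj₁ w) (sym (walk-∷ ds cs v k)) (there (∈-++⁺ˡ e∈))

  ∈-walk-sibling : ∀ {ds cs v k e} → e ∈ proj₁ (walk cs v (suc (contourEnd ds (suc k)))) →
    e ∈ proj₁ (walk (node ds ∷ cs) v k)
  ∈-walk-sibling {ds} {cs} {v} {k} e∈ rewrite walk-∷ ds cs v k | walk-end ds (suc k) (suc k) =
    ∈-++⁺ʳ (_ ∷ _) e∈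

  Move-child : ∀ ds cs v k → Move ds (suc k) (suc k) → Move (node ds ∷ cs) v k
  Move-child ds cs v k m = record
    { cs' = node ds' ∷ cs
    ; i = i ; j = j ; i' = i' ; j' = j' ; i<j = i<j ; j<i' = j<i' ; i'<j' = i'<j'
    ; e₁ = e₁ ; e₂ = e₂ ; e₁∈ = ∈-walk-child {ds} {cs} e₁∈ ; e₁≡ = e₁≡
    ; e₂∈ = ∈-walk-child {ds} {cs} e₂∈ ; e₂≡ = e₂≡ ; shared = shared
    ; replaces = subst (λ E → Replaces _ _ _ _ (contourPairs (node ds ∷ cs) k)
                                 ((suc k , suc E) ∷ contourPairs ds' (suc k) ++ contourPairs cs (suc E)))
                       (sym E'≡E)
                       (Replaces-frameˡ ((suc k , suc E) ∷ [])
                         (Replaces-frameʳ (contourPairs cs (suc E)) replaces))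
    ; valid-ij = valid-ij ; valid-i'j' = valid-i'j'
    }
    where
    open Move m renaming (cs' to ds')
    E = contourEnd ds (suc k)
    E'≡E : contourEnd ds' (suc k) ≡ E
    E'≡E = length≡⇒contourEnd≡ ds' ds (suc k) (Replaces-length replaces)

  Move-sibling : ∀ ds cs v k → Move cs v (suc (contourEnd ds (suc k))) → Move (node ds ∷ cs) v k
  Move-sibling ds cs v k m = record
    { cs' = node ds ∷ cs'
    ; i = i ; j = j ; i' = i' ; j' = j' ; i<j = i<j ; j<i' = j<i' ; i'<j' = i'<j'
    ; e₁ = e₁ ; e₂ = e₂ ; e₁∈ = ∈-walk-sibling {ds} {cs} e₁∈ ; e₁≡ = e₁≡
    ; e₂∈ = ∈-walk-sibling {ds} {cs} e₂∈ ; e₂≡ = e₂≡ ; shared = shared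
    ; replaces = Replaces-frameˡ ((suc k , _) ∷ contourPairs ds (suc k)) replaces
    ; valid-ij = valid-ij ; valid-i'j' = valid-i'j'
    }
    where open Move m

  ∈-walk-head : ∀ ds cs v k →
    edge (suc k) (suc (contourEnd ds (suc k))) v (suc k) ∈ proj₁ (walk (node ds ∷ cs) v k)
  ∈-walk-head ds cs v k rewrite walk-∷ ds cs v k | walk-end ds (suc k) (suc k) = here refl

  ∈-walk-middle : ∀ dpre es dpost u k → let K = contourEnd dpre k in
    edge (suc K) (suc (contourEnd es (suc K))) u (suc K) ∈ proj₁ (walk (dpre ++ node es ∷ dpost) u k)
  ∈-walk-middle dpre es dpost u k
    rewrite walk-++ dpre (node es ∷ dpost) u k | walk-end dpre u k
          | walk-∷ es dpost u (contourEnd dpre k)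
          | walk-end es (suc (contourEnd dpre k)) (suc (contourEnd dpre k)) =
    ∈-++⁺ʳ _ (here refl)

  -- The edge e(i , j') leads to node (dpre ++ node es ∷ dpost) and e(j , i') to node es.
  -- After the move e(i , j) carries dpre, e(i' , j') carries dpost, and es are
  -- lifted to siblings between them.
  Move-here : ∀ dpre es dpost cs v k →
    All ValidPair (contourPairs (node (dpre ++ node es ∷ dpost) ∷ cs) k) →
    ValidPair (suc k , suc (contourEnd dpre (suc k))) →
    Move (node (dpre ++ node es ∷ dpost) ∷ cs) v k
  Move-here dpre es dpost cs v k valid valid-ij = record
    { cs' = node dpre ∷ (es ++ node dpost ∷ cs)
    ; i = suc k ; j = suc m ; i' = suc m₂ ; j' = suc k₁
    ; i<j = s≤s (≤-contourEnd dpre (suc k))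
    ; j<i' = s≤s (≤-contourEnd es (suc m))
    ; i'<j' = s≤s (≤-contourEnd dpost (suc m₂))
    ; e₁ = edge (suc k) (suc (contourEnd ds (suc k))) v (suc k)
    ; e₂ = edge (suc m) (suc m₂) (suc k) (suc m)
    ; e₁∈ = ∈-walk-head ds cs v k
    ; e₁≡ = cong (λ e → (suc k , suc e)) end-ds
    ; e₂∈ = ∈-walk-child {ds} {cs} (∈-walk-middle dpre es dpost (suc k) (suc k))
    ; e₂≡ = refl
    ; shared = inj₂ (inj₂ (inj₁ refl))
    ; replaces = record
      { rest = O ++ Es ++ D ++ C
      ; old↭ = ↭-trans (↭-reflexive old≡) (nested↭ (suc k , suc k₁) (suc m , suc m₂) O Es D C)
      ; new↭ = ↭-trans (↭-reflexive new≡) (unnested↭ (suc k , suc m) (suc m₂ , suc k₁) O Es D C)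
      }
    ; valid-ij = valid-ij
    ; valid-i'j' = ValidPair-unnest (All.lookup valid' (here refl)) valid-ij
                                    (All.lookup valid' (there (∈-++⁺ˡ (∈-++⁺ʳ O (here refl)))))
    }
    where
    ds = dpre ++ node es ∷ dpost
    m = contourEnd dpre (suc k)
    m₂ = contourEnd es (suc m)
    k₁ = contourEnd dpost (suc m₂)
    O = contourPairs dpre (suc k)
    Es = contourPairs es (suc m)
    D = contourPairs dpost (suc m₂)
    C = contourPairs cs (suc k₁)
    end-ds : contourEnd ds (suc k) ≡ k₁
    end-ds = contourEnd-++ dpre (node es ∷ dpost) (suc k)
    old≡ : contourPairs (node ds ∷ cs) k ≡ (suc k , suc k₁) ∷ ((O ++ (suc m , suc m₂) ∷ (Es ++ D)) ++ C)
    old≡ rewrite end-ds | contourPairs-++ dpre (node es ∷ dpost) (suc k) = refl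
    new≡ : contourPairs (node dpre ∷ (es ++ node dpost ∷ cs)) k
         ≡ (suc k , suc m) ∷ (O ++ (Es ++ (suc m₂ , suc k₁) ∷ (D ++ C)))
    new≡ rewrite contourPairs-++ es (node dpost ∷ cs) (suc m) = refl
    valid' : All ValidPair ((suc k , suc k₁) ∷ ((O ++ (suc m , suc m₂) ∷ (Es ++ D)) ++ C))
    valid' = subst (All ValidPair) old≡ valid

  -- suc (contourEnd dpre k) is the left side of the edge down to node es.
  record Split (y : Maybe Carrier) (ds : List PTree) (k : ℕ) : Set where
    constructor split
    field
      dpre es dpost : List PTree
      ds≡           : ds ≡ dpre ++ node es ∷ dpost
      complements   : Complements 𝒜 y (at 𝒜 P (suc (contourEnd dpre k)))

  complements? : ∀ ma mb → Dec (Complements 𝒜 ma mb)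
  complements? (just a) (just b) = b ≟ᶜ comp a
  complements? (just a) nothing  = no λ ()
  complements? nothing  mb       = no λ ()

  reduced⊎split⊎move : ∀ y cs v k → All ValidPair (contourPairs cs k) →
    Reduced y cs k ⊎ Split y cs k ⊎ Move cs v k
  reduced⊎split⊎move y []              v k _ = inj₁ tt
  reduced⊎split⊎move y (node ds ∷ cs) v k valid@(_ ∷ valid-ds++cs)
    with All.++⁻ (contourPairs ds (suc k)) valid-ds++cs
  ... | valid-ds , valid-cs with reduced⊎split⊎move (at 𝒜 P (suc k)) ds (suc k) (suc k) valid-ds
  ... | inj₂ (inj₂ m) = inj₂ (inj₂ (Move-child ds cs v k m))
  ... | inj₂ (inj₁ (split dpre es dpost refl valid-ij)) =
    inj₂ (inj₂ (Move-here dpre es dpost cs v k valid valid-ij))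
  ... | inj₁ red-ds with complements? y (at 𝒜 P (suc k))
  ...   | yes c = inj₂ (inj₁ (split [] ds cs refl c))
  ...   | no nc with reduced⊎split⊎move y cs v (suc (contourEnd ds (suc k))) valid-cs
  ...     | inj₁ red-cs = inj₁ (nc , red-ds , red-cs)
  ...     | inj₂ (inj₁ (split dpre es dpost refl c)) = inj₂ (inj₁ (split (node ds ∷ dpre) es dpost refl c))
  ...     | inj₂ (inj₂ m) = inj₂ (inj₂ (Move-sibling ds cs v k m))

  path-to-greedy : ∀ T T₀ → IsGreedyTree 𝒜 P T₀ → Valid 𝒜 P T → Acc _<_ (weight (pairs T)) →
    Star (Type2 𝒜 P) T T₀
  path-to-greedy (node cs) T₀ greedy₀ valid (acc smaller)
    with reduced⊎split⊎move nothing cs 0 0 (proj₂ (valid⇒contour cs valid))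
  ... | inj₁ red =
    subst (Star (Type2 𝒜 P) (node cs)) (reduced⇒greedyTree cs T₀ valid red greedy₀) ε
  ... | inj₂ (inj₁ (split _ _ _ _ ()))
  ... | inj₂ (inj₂ m) =
    step ◅ path-to-greedy T' T₀ greedy₀ (proj₁ (proj₂ step)) (smaller (Type2-weight< (node cs) T' step))
    where
    T' = node (Move.cs' m)
    step = Move⇒Type2 cs valid m

mainTheorem5 : (𝒜 : CompAlphabet) (P : List (CompAlphabet.Carrier 𝒜)) →
    Σ PTree (Valid 𝒜 P) →
    (T₀ : PTree) → Valid 𝒜 P T₀ → IsGreedyTree 𝒜 P T₀ →
    ((T : PTree) → Valid 𝒜 P T → ¬ TransClosure (Type2 𝒜 P) T T)
    × ((T : PTree) → Valid 𝒜 P T → Star (Type2 𝒜 P) T T₀)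
mainTheorem5 𝒜 P _ T₀ _ greedy₀ =
  (λ T _ cycle → <-irrefl refl (TransClosure-weight< cycle)) ,
  (λ T valid → path-to-greedy T T₀ greedy₀ valid (<-wellFounded _))
  where open Word 𝒜 P
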